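{- Let an instance of FZA on a path $T$ be given, with edges $e^{(1)},\dots,e^{(n-1)}$ from left to right, and let $F^*$ be an optimal solution. For every $j\in\{0,1,\dots,\lceil\log_2 n\rceil\}$, the set $F_j$ defined below satisfies $\mathrm{rev}_{M_j}(F_j)\ge\frac16\,\mathrm{rev}_{M_j}(F^*)$.
   Context: FZA: given a tree $T=(V,E)$ with $n=|V|$, a non-decreasing concave $f\colon\mathbb{N}_0\to\mathbb{R}_{\ge0}$ and commodities $i\in[k]$ with path $P_i\subseteq E$, bound $u_i\in\mathbb{N}_0$ and weight $w_i\in\mathbb{N}$, maximize $\sum_i\mathrm{rev}_i(F)$, where $\mathrm{rev}_i(F)=w_if(|P_i\cap F|)$ if $|P_i\cap F|\le u_i$ and $0$ otherwise; for $M\subseteq[k]$, $\mathrm{rev}_M(F)=\sum_{i\in M}\mathrm{rev}_i(F)$. Let $d_i=u_i/|P_i|$, $M_0=\{i:u_i=0\}$ and, for $j\ge1$, $M_j=\{i: u_i\ge1,\ d_i\in(2^{ -j},2^{1-j}]\}$. Set $F_0=\emptyset$; for $j\ge1$ and $\theta\in\{1,\dots,2^j\}$ let $F_{j,\theta}=\{e^{(\theta')}:\theta'\equiv\theta\bmod 2^j\}$, and let $F_j$ be a best candidate among the $F_{j,\theta}$ (maximizing $\mathrm{rev}_{M_j}$).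
   Formalization: The function f takes nonnegative rational values rather than nonnegative real values. -}

module Defs where

open import Data.Bool using (Bool; true; false; if_then_else_; _∧_)
open import Data.Nat as ℕ using (ℕ; zero; suc; _∸_; _^_; _≤ᵇ_; _<ᵇ_; _≡ᵇ_; NonZero)
open import Data.Nat.DivMod using (_%_)
open import Data.Nat.Properties using (m^n≢0)
open import Data.Fin using (Fin)
open import Data.List using (List; []; _∷_; length; filterᵇ; allFin; map; foldr)
open import Data.Integer using (+_)
open import Data.Rational as ℚ using (ℚ; 0ℚ; _/_; _+_; _*_; _-_; _≤_)

toℚ : ℕ → ℚ
toℚ m = (+ m) / 1

sumℚ : List ℚ → ℚ
sumℚ = foldr _+_ 0ℚ

NonNeg : (ℕ → ℚ) → Set
NonNeg f = ∀ x → 0ℚ ≤ f x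

NonDecreasing : (ℕ → ℚ) → Set
NonDecreasing f = ∀ x → f x ≤ f (suc x)

Concave : (ℕ → ℚ) → Set
Concave f = ∀ x → f (suc (suc x)) - f (suc x) ≤ f (suc x) - f x

-- An FZA instance on the path with n vertices and edges e⁽¹⁾,…,e⁽ⁿ⁻¹⁾
-- (edge e⁽ᵗ⁾ is represented by the index t, 1 ≤ t ≤ n-1).
-- Commodity i has path P_i = {e⁽ᵃⁱ⁾, …, e⁽ᵇⁱ⁾} (a nonempty subpath),
-- bound u_i ∈ ℕ₀ and weight w_i ∈ ℕ (w_i ≥ 1).
record Instance (n : ℕ) : Set where
  field
    k     : ℕ
    a b u w : Fin k → ℕ
    a≥1   : ∀ i → 1 ℕ.≤ a i
    a≤b   : ∀ i → a i ℕ.≤ b i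
    b≤n-1 : ∀ i → b i ℕ.≤ n ∸ 1
    w≥1   : ∀ i → 1 ℕ.≤ w i

seg : ℕ → ℕ → List ℕ
seg s zero    = []
seg s (suc l) = s ∷ seg (suc s) l

EdgeSet : Set
EdgeSet = ℕ → Bool

module _ {n : ℕ} (I : Instance n) (f : ℕ → ℚ) where
  open Instance I

  P : Fin k → List ℕ
  P i = seg (a i) (suc (b i) ∸ a i)

  len : Fin k → ℕ
  len i = length (P i)

  inter : Fin k → EdgeSet → ℕ
  inter i F = length (filterᵇ F (P i))

  rev : Fin k → EdgeSet → ℚ
  rev i F = if inter i F ≤ᵇ u i then toℚ (w i) * f (inter i F) else 0ℚ

  revM : (Fin k → Bool) → EdgeSet → ℚ
  revM M F = sumℚ (map (λ i → if M i then rev i F else 0ℚ) (allFin k))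

  revAll : EdgeSet → ℚ
  revAll = revM (λ _ → true)

  -- M_0 = {i : u_i = 0};  for j ≥ 1,
  -- M_j = {i : u_i ≥ 1, d_i = u_i/|P_i| ∈ (2^{-j}, 2^{1-j}]}, i.e. (|P_i| > 0)
  --   2^{-j} < u_i/|P_i|  ⇔  |P_i| < 2^j u_i,
  --   u_i/|P_i| ≤ 2^{1-j} ⇔  2^{j-1} u_i ≤ |P_i|.
  Mclass : ℕ → Fin k → Bool
  Mclass zero    i = u i ≡ᵇ 0
  Mclass (suc j) i = (1 ≤ᵇ u i) ∧ ((len i <ᵇ 2 ^ suc j ℕ.* u i) ∧ (2 ^ j ℕ.* u i ≤ᵇ len i))

Fjθ : ℕ → ℕ → EdgeSet
Fjθ j θ t = (_%_ t (2 ^ j) {{m^n≢0 2 j}}) ≡ᵇ (_%_ θ (2 ^ j) {{m^n≢0 2 j}})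

F₀ : EdgeSet
F₀ _ = false

Optimal : {n : ℕ} → Instance n → (ℕ → ℚ) → EdgeSet → Set
Optimal I f F* = ∀ F → revAll I f F ≤ revAll I f F*

BestCandidate : {n : ℕ} → Instance n → (ℕ → ℚ) → ℕ → ℕ → Set
BestCandidate I f j θ =
  (1 ℕ.≤ θ) × (θ ℕ.≤ 2 ^ j) ×
  (∀ θ' → 1 ℕ.≤ θ' → θ' ℕ.≤ 2 ^ j →
     revM I f (Mclass I f j) (Fjθ j θ') ≤ revM I f (Mclass I f j) (Fjθ j θ))
  where open import Data.Product using (_×_)

{-# OPTIONS --safe #-}
module Submission where

-- For u_i = 0 only the empty intersection earns anything, so F₀ = ∅ is already best on M₀.
-- For i ∈ M_j with j ≥ 1 and N = 2^j we have N u_i / 2 ≤ |P_i| < N u_i.  The N residue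
-- classes F_{j,θ} partition P_i, and a subpath shorter than N u_i meets each class in at most
-- u_i edges, so no class exceeds the bound.  Concavity with f(0) ≥ 0 makes x ↦ f(x)/x
-- non-increasing, hence Σ_θ rev_i(F_{j,θ}) = w_i Σ_θ f(|P_i ∩ F_{j,θ}|) ≥ w_i (|P_i| / u_i) f(u_i)
-- ≥ (N/2) rev_i(F*).  Summing over i and comparing the average class with the best one gives
-- rev_{M_j}(F*) ≤ 2 rev_{M_j}(F_j), better than the claimed factor 6.

open import Algebra.Bundles using (CommutativeMonoid)
open import Data.Bool using (Bool; true; false; T; if_then_else_)
open import Data.Bool.Properties using (T?; T-≡; T-∧)
open import Data.Fin using (Fin)
import Data.Integer as ℤ
import Data.Integer.Properties as ℤ
open import Data.List using (List; []; _∷_; [_]; _++_; map; length; filterᵇ; foldr; allFin)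
open import Data.List.Properties
  using (length-++; filter-++; filter-accept; filter-reject; filter-none; filter-≐; map-cong; map-cong-local)
open import Data.List.Relation.Unary.All as All using (All; []; _∷_)
open import Data.Nat as ℕ using (ℕ; zero; suc; _≤_; _<_; _^_; _≤ᵇ_; _≡ᵇ_; z≤n; s≤s; NonZero)
open import Data.Nat.ListAction using (sum)
open import Data.Nat.Logarithm using (⌈log₂_⌉)
import Data.Nat.Properties as ℕ
open import Data.Product using (_×_; _,_; proj₂)
import Data.Rational.Properties as ℚ
open import Data.Rational.Solver using (module +-*-Solver)
open import Data.Rational.Unnormalised as ℚᵘ using (mkℚᵘ; *≡*; *≤*)
import Data.Rational.Unnormalised.Properties as ℚᵘ
open import Function using (_∘_; Equivalence)
open import Relation.Binary.PropositionalEquality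
  using (_≡_; refl; sym; trans; cong; cong₂; subst; subst₂; module ≡-Reasoning)
open import Relation.Nullary using (¬_; yes; no; contradiction)
open import Defs

open Equivalence using (to; from)

module ListSum {c ℓ} (M : CommutativeMonoid c ℓ) where
  open CommutativeMonoid M using (Carrier; _≈_; _∙_; ε; identityˡ; ∙-congˡ; commutativeSemigroup; setoid)
    renaming (refl to ≈-refl; sym to ≈-sym; trans to ≈-trans)
  open import Algebra.Properties.CommutativeSemigroup commutativeSemigroup using (interchange)
  open import Relation.Binary.Reasoning.Setoid setoid

  ∑ : {A : Set} → (A → Carrier) → List A → Carrier
  ∑ g xs = foldr _∙_ ε (map g xs)

  ∑-ε : {A : Set} (xs : List A) → ∑ (λ _ → ε) xs ≈ ε
  ∑-ε []       = ≈-refl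
  ∑-ε (x ∷ xs) = ≈-trans (identityˡ _) (∑-ε xs)

  ∑-∙ : {A : Set} (g h : A → Carrier) (xs : List A) → ∑ (λ x → g x ∙ h x) xs ≈ ∑ g xs ∙ ∑ h xs
  ∑-∙ g h []       = ≈-sym (identityˡ ε)
  ∑-∙ g h (x ∷ xs) = begin
    (g x ∙ h x) ∙ ∑ (λ x → g x ∙ h x) xs  ≈⟨ ∙-congˡ (∑-∙ g h xs) ⟩
    (g x ∙ h x) ∙ (∑ g xs ∙ ∑ h xs)        ≈⟨ interchange (g x) (h x) (∑ g xs) (∑ h xs) ⟩
    (g x ∙ ∑ g xs) ∙ (h x ∙ ∑ h xs)        ∎

  ∑-comm : {A B : Set} (g : A → B → Carrier) (xs : List A) (ys : List B) →
           ∑ (λ x → ∑ (g x) ys) xs ≈ ∑ (λ y → ∑ (λ x → g x y) xs) ys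
  ∑-comm g []       ys = ≈-sym (∑-ε ys)
  ∑-comm g (x ∷ xs) ys = begin
    ∑ (g x) ys ∙ ∑ (λ x → ∑ (g x) ys) xs
      ≈⟨ ∙-congˡ (∑-comm g xs ys) ⟩
    ∑ (g x) ys ∙ ∑ (λ y → ∑ (λ x → g x y) xs) ys
      ≈⟨ ∑-∙ (g x) (λ y → ∑ (λ x → g x y) xs) ys ⟨
    ∑ (λ y → g x y ∙ ∑ (λ x → g x y) xs) ys
      ∎

module ℕ∑ = ListSum ℕ.+-0-commutativeMonoid
module ℚ∑ = ListSum ℚ.+-0-commutativeMonoid

module SegmentCounting where
  open import Data.Nat using (_+_; _*_)
  open import Data.Nat.DivMod using (_%_; _/_; m≡m%n+[m/n]*n; m%n<n; m<n⇒m%n≡m; [m+n]%n≡m%n)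
  open import Data.Nat.Properties
    using (module ≤-Reasoning; ≤-refl; ≤-reflexive; ≤-trans; <-≤-trans; <⇒≤; <⇒≢; <⇒≱; ≤⇒≯; ≰⇒>; ≤∧≢⇒<;
           _≟_; _≤?_; +-identityʳ; +-suc; +-assoc; +-comm; +-mono-≤; +-monoʳ-≤; +-cancelˡ-≤; *-monoˡ-≤;
           m<m+n; m≤n⇒∃[o]m+o≡n; ≡ᵇ⇒≡; ≡⇒≡ᵇ)

  count : (ℕ → Bool) → List ℕ → ℕ
  count p xs = length (filterᵇ p xs)

  count-++ : ∀ p xs ys → count p (xs ++ ys) ≡ count p xs + count p ys
  count-++ p xs ys = trans (cong length (filter-++ (T? ∘ p) xs ys)) (length-++ (filterᵇ p xs))

  count-cong : ∀ {p q} → (∀ t → p t ≡ q t) → ∀ xs → count p xs ≡ count q xs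
  count-cong p≗q xs = cong length (filter-≐ (T? ∘ _) (T? ∘ _)
    ((λ {t} → subst T (p≗q t)) , (λ {t} → subst T (sym (p≗q t)))) xs)

  count-none : ∀ xs → count (λ _ → false) xs ≡ 0
  count-none xs = cong length (filter-none (T? ∘ _) (All.universal (λ _ ()) xs))

  ∑-count-singleton : ∀ x (p : ℕ → ℕ → Bool) ys →
                      sum (map (λ y → count (p y) [ x ]) ys) ≡ count (λ y → p y x) ys
  ∑-count-singleton x p []       = refl
  ∑-count-singleton x p (y ∷ ys) with p y x
  ... | true  = cong suc (∑-count-singleton x p ys)
  ... | false = ∑-count-singleton x p ys

  length-seg : ∀ s m → length (seg s m) ≡ m
  length-seg s zero    = refl
  length-seg s (suc m) = cong suc (length-seg (suc s) m)

  seg-++ : ∀ s m l → seg s (m + l) ≡ seg s m ++ seg (s + m) l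
  seg-++ s zero    l = cong (λ s → seg s l) (sym (+-identityʳ s))
  seg-++ s (suc m) l = cong (s ∷_) (trans (seg-++ (suc s) m l)
                                          (cong (λ s′ → seg (suc s) m ++ seg s′ l) (sym (+-suc s m))))

  seg-bounds : ∀ s m → All (λ t → s ≤ t × t < s + m) (seg s m)
  seg-bounds s zero    = []
  seg-bounds s (suc m) = (≤-refl , m<m+n s ℕ.z<s) ∷ All.map shift (seg-bounds (suc s) m)
    where
    shift : ∀ {t} → suc s ≤ t × t < suc s + m → s ≤ t × t < s + suc m
    shift {t} (s<t , t<) = <⇒≤ s<t , subst (t <_) (sym (+-suc s m)) t<

  count-≡ᵇ-seg : ∀ {r} s m → s ≤ r → r < s + m → count (r ≡ᵇ_) (seg s m) ≡ 1
  count-≡ᵇ-seg {r} s zero    s≤r r<s+0 = contradiction (subst (r <_) (+-identityʳ s) r<s+0) (≤⇒≯ s≤r)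
  count-≡ᵇ-seg {r} s (suc m) s≤r r<s+m with r ≟ s
  ... | yes refl = begin
    count (r ≡ᵇ_) (r ∷ seg (suc r) m)
      ≡⟨ cong length (filter-accept (T? ∘ (r ≡ᵇ_)) (≡⇒≡ᵇ r r refl)) ⟩
    suc (count (r ≡ᵇ_) (seg (suc r) m))
      ≡⟨ cong suc (cong length (filter-none (T? ∘ (r ≡ᵇ_)) (All.map later (seg-bounds (suc r) m)))) ⟩
    1 ∎
    where
    open ≡-Reasoning
    later : ∀ {t} → suc r ≤ t × t < suc r + m → ¬ T (r ≡ᵇ t)
    later (r<t , _) r≡t = <⇒≢ r<t (≡ᵇ⇒≡ r _ r≡t)
  ... | no r≢s = trans (cong length (filter-reject (T? ∘ (r ≡ᵇ_)) (r≢s ∘ ≡ᵇ⇒≡ r s)))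
                       (count-≡ᵇ-seg (suc s) m (≤∧≢⇒< s≤r (r≢s ∘ sym)) (subst (r <_) (+-suc s m) r<s+m))

  module Residues (N : ℕ) .{{_ : NonZero N}} where

    residue : ℕ → ℕ → Bool
    residue θ t = t % N ≡ᵇ θ % N

    residue-periodic : ∀ θ t → residue (θ + N) t ≡ residue θ t
    residue-periodic θ t = cong (t % N ≡ᵇ_) ([m+n]%n≡m%n θ N)

    ∑-count-residue : ∀ xs → sum (map (λ θ → count (residue θ) xs) (seg 0 N)) ≡ length xs
    ∑-count-residue []       = ℕ∑.∑-ε (seg 0 N)
    ∑-count-residue (x ∷ xs) = begin
      sum (map (λ θ → count (residue θ) ([ x ] ++ xs)) (seg 0 N))
        ≡⟨ cong sum (map-cong (λ θ → count-++ (residue θ) [ x ] xs) (seg 0 N)) ⟩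
      sum (map (λ θ → count (residue θ) [ x ] + count (residue θ) xs) (seg 0 N))
        ≡⟨ ℕ∑.∑-∙ (λ θ → count (residue θ) [ x ]) (λ θ → count (residue θ) xs) (seg 0 N) ⟩
      sum (map (λ θ → count (residue θ) [ x ]) (seg 0 N)) + sum (map (λ θ → count (residue θ) xs) (seg 0 N))
        ≡⟨ cong₂ _+_ x-hit-once (∑-count-residue xs) ⟩
      suc (length xs) ∎
      where
      open ≡-Reasoning
      x-hit-once : sum (map (λ θ → count (residue θ) [ x ]) (seg 0 N)) ≡ 1
      x-hit-once = begin
        sum (map (λ θ → count (residue θ) [ x ]) (seg 0 N))
          ≡⟨ cong sum (map-cong-local (All.map (cong (λ r → count (λ t → t % N ≡ᵇ r) [ x ]) ∘ m<n⇒m%n≡m ∘ proj₂)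
                                               (seg-bounds 0 N))) ⟩
        sum (map (λ θ → count (λ t → t % N ≡ᵇ θ) [ x ]) (seg 0 N))
          ≡⟨ ∑-count-singleton x (λ θ t → t % N ≡ᵇ θ) (seg 0 N) ⟩
        count (x % N ≡ᵇ_) (seg 0 N)
          ≡⟨ count-≡ᵇ-seg 0 N z≤n (m%n<n x N) ⟩
        1 ∎

    residue-gap : ∀ {s t} → s < t → t % N ≡ s % N → s + N ≤ t
    residue-gap {s} {t} s<t t≡s = begin
      s + N                    ≡⟨ cong (_+ N) (m≡m%n+[m/n]*n s N) ⟩
      s % N + s / N * N + N    ≡⟨ trans (+-assoc (s % N) _ N) (cong (s % N +_) (+-comm _ N)) ⟩
      s % N + suc (s / N) * N  ≤⟨ +-monoʳ-≤ (s % N) (*-monoˡ-≤ N quotient-grows) ⟩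
      s % N + t / N * N        ≡⟨ cong (_+ t / N * N) t≡s ⟨
      t % N + t / N * N        ≡⟨ m≡m%n+[m/n]*n t N ⟨
      t                        ∎
      where
      open ≤-Reasoning
      quotient-grows : s / N < t / N
      quotient-grows = ≰⇒> λ t/N≤s/N → <⇒≱ s<t (begin
        t                  ≡⟨ m≡m%n+[m/n]*n t N ⟩
        t % N + t / N * N  ≤⟨ +-mono-≤ (≤-reflexive t≡s) (*-monoˡ-≤ N t/N≤s/N) ⟩
        s % N + s / N * N  ≡⟨ m≡m%n+[m/n]*n s N ⟨
        s                  ∎)

    count-residue-window : ∀ θ s m → m ≤ N → count (residue θ) (seg s m) ≤ 1
    count-residue-window θ s zero    _   = z≤n
    count-residue-window θ s (suc m) m<N with T? (residue θ s)
    ... | yes s∈θ = ≤-reflexive (begin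
      count (residue θ) (s ∷ seg (suc s) m)
        ≡⟨ cong length (filter-accept (T? ∘ residue θ) s∈θ) ⟩
      suc (count (residue θ) (seg (suc s) m))
        ≡⟨ cong suc (cong length (filter-none (T? ∘ residue θ) (All.map too-close (seg-bounds (suc s) m)))) ⟩
      1 ∎)
      where
      open ≡-Reasoning
      too-close : ∀ {t} → suc s ≤ t × t < suc s + m → ¬ T (residue θ t)
      too-close (s<t , t<s+m) t∈θ =
        <⇒≱ (<-≤-trans t<s+m (subst (_≤ s + N) (+-suc s m) (+-monoʳ-≤ s m<N)))
            (residue-gap s<t (trans (≡ᵇ⇒≡ _ _ t∈θ) (sym (≡ᵇ⇒≡ _ _ s∈θ))))
    ... | no s∉θ = subst (_≤ 1) (cong length (sym (filter-reject (T? ∘ residue θ) s∉θ)))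
                         (count-residue-window θ (suc s) m (<⇒≤ m<N))

    count-residue-seg : ∀ θ s q {L} → L ≤ q * N → count (residue θ) (seg s L) ≤ q
    count-residue-seg θ s zero    z≤n = z≤n
    count-residue-seg θ s (suc q) {L} L≤ with L ≤? N
    ... | yes L≤N = ≤-trans (count-residue-window θ s L L≤N) (s≤s z≤n)
    ... | no L≰N with m≤n⇒∃[o]m+o≡n (<⇒≤ (≰⇒> L≰N))
    ... | o , refl = begin
      count (residue θ) (seg s (N + o))
        ≡⟨ cong (count (residue θ)) (seg-++ s N o) ⟩
      count (residue θ) (seg s N ++ seg (s + N) o)
        ≡⟨ count-++ (residue θ) (seg s N) _ ⟩
      count (residue θ) (seg s N) + count (residue θ) (seg (s + N) o)
        ≤⟨ +-mono-≤ (count-residue-window θ s N ≤-refl)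
                    (count-residue-seg θ (s + N) q (+-cancelˡ-≤ N o (q * N) L≤)) ⟩
      suc q ∎
      where open ≤-Reasoning

open SegmentCounting

open import Data.Rational as ℚ using (ℚ; 0ℚ; 1ℚ; _+_; _*_; _-_; NonNegative; Positive) renaming (_≤_ to _≤ℚ_)
open import Algebra.Properties.CommutativeSemigroup
  (CommutativeMonoid.commutativeSemigroup ℚ.*-1-commutativeMonoid) using (x∙yz≈y∙xz; x∙yz≈yx∙z)

private
  toℚᵘ-toℚ : ∀ m → ℚ.toℚᵘ (toℚ m) ℚᵘ.≃ mkℚᵘ (ℤ.+ m) 0
  toℚᵘ-toℚ m = ℚ.toℚᵘ-fromℚᵘ (mkℚᵘ (ℤ.+ m) 0)

toℚ-+ : ∀ m n → toℚ (m ℕ.+ n) ≡ toℚ m + toℚ n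
toℚ-+ m n = ℚ.toℚᵘ-injective (begin
  ℚ.toℚᵘ (toℚ (m ℕ.+ n))                   ≈⟨ toℚᵘ-toℚ (m ℕ.+ n) ⟩
  mkℚᵘ (ℤ.+ (m ℕ.+ n)) 0                   ≈⟨ *≡* (cong (ℤ._* ℤ.+ 1) numerators) ⟩
  mkℚᵘ (ℤ.+ m) 0 ℚᵘ.+ mkℚᵘ (ℤ.+ n) 0      ≈⟨ ℚᵘ.+-cong (toℚᵘ-toℚ m) (toℚᵘ-toℚ n) ⟨
  ℚ.toℚᵘ (toℚ m) ℚᵘ.+ ℚ.toℚᵘ (toℚ n)      ≈⟨ ℚ.toℚᵘ-homo-+ (toℚ m) (toℚ n) ⟨
  ℚ.toℚᵘ (toℚ m + toℚ n)                   ∎)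
  where
  open import Relation.Binary.Reasoning.Setoid ℚᵘ.≃-setoid
  numerators : ℤ.+ (m ℕ.+ n) ≡ ℤ.+ m ℤ.* ℤ.+ 1 ℤ.+ ℤ.+ n ℤ.* ℤ.+ 1
  numerators = trans (ℤ.pos-+ m n) (sym (cong₂ ℤ._+_ (ℤ.*-identityʳ (ℤ.+ m)) (ℤ.*-identityʳ (ℤ.+ n))))

toℚ-* : ∀ m n → toℚ (m ℕ.* n) ≡ toℚ m * toℚ n
toℚ-* m n = ℚ.toℚᵘ-injective (begin
  ℚ.toℚᵘ (toℚ (m ℕ.* n))                   ≈⟨ toℚᵘ-toℚ (m ℕ.* n) ⟩
  mkℚᵘ (ℤ.+ (m ℕ.* n)) 0                   ≈⟨ *≡* (cong (ℤ._* ℤ.+ 1) (ℤ.pos-* m n)) ⟩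
  mkℚᵘ (ℤ.+ m) 0 ℚᵘ.* mkℚᵘ (ℤ.+ n) 0      ≈⟨ ℚᵘ.*-cong (toℚᵘ-toℚ m) (toℚᵘ-toℚ n) ⟨
  ℚ.toℚᵘ (toℚ m) ℚᵘ.* ℚ.toℚᵘ (toℚ n)      ≈⟨ ℚ.toℚᵘ-homo-* (toℚ m) (toℚ n) ⟨
  ℚ.toℚᵘ (toℚ m * toℚ n)                   ∎)
  where open import Relation.Binary.Reasoning.Setoid ℚᵘ.≃-setoid

toℚ-mono-≤ : ∀ {m n} → m ≤ n → toℚ m ≤ℚ toℚ n
toℚ-mono-≤ {m} {n} m≤n = ℚ.toℚᵘ-cancel-≤
  (ℚᵘ.≤-respʳ-≃ (ℚᵘ.≃-sym (toℚᵘ-toℚ n)) (ℚᵘ.≤-respˡ-≃ (ℚᵘ.≃-sym (toℚᵘ-toℚ m))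
    (*≤* (ℤ.*-monoʳ-≤-nonNeg (ℤ.+ 1) (ℤ.+≤+ m≤n)))))

toℚ-nonNeg : ∀ m → NonNegative (toℚ m)
toℚ-nonNeg m = ℚ.normalize-nonNeg m 1

toℚ-pos : ∀ m .{{_ : NonZero m}} → Positive (toℚ m)
toℚ-pos m = ℚ.normalize-pos m 1

toℚ-*-monoˡ-≤ : ∀ {m n} q → 0ℚ ≤ℚ q → m ≤ n → toℚ m * q ≤ℚ toℚ n * q
toℚ-*-monoˡ-≤ q q≥0 m≤n = ℚ.*-monoʳ-≤-nonNeg q {{ℚ.nonNegative q≥0}} (toℚ-mono-≤ m≤n)

≤-toℚ-* : ∀ {m} q → 0ℚ ≤ℚ q → 1 ≤ m → q ≤ℚ toℚ m * q
≤-toℚ-* q q≥0 1≤m = ℚ.≤-trans (ℚ.≤-reflexive (sym (ℚ.*-identityˡ q))) (toℚ-*-monoˡ-≤ q q≥0 1≤m)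

open ℚ∑ using (∑)
open ℚ.≤-Reasoning
open +-*-Solver

module _ {A : Set} where

  ∑-*ˡ : ∀ c (g : A → ℚ) xs → ∑ (λ x → c * g x) xs ≡ c * ∑ g xs
  ∑-*ˡ c g []       = sym (ℚ.*-zeroʳ c)
  ∑-*ˡ c g (x ∷ xs) = trans (cong (c * g x +_) (∑-*ˡ c g xs)) (sym (ℚ.*-distribˡ-+ c (g x) (∑ g xs)))

  ∑-*ʳ : ∀ c (g : A → ℚ) xs → ∑ (λ x → g x * c) xs ≡ ∑ g xs * c
  ∑-*ʳ c g []       = sym (ℚ.*-zeroˡ c)
  ∑-*ʳ c g (x ∷ xs) = trans (cong (g x * c +_) (∑-*ʳ c g xs)) (sym (ℚ.*-distribʳ-+ c (g x) (∑ g xs)))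

  ∑-toℚ : ∀ (g : A → ℕ) xs → ∑ (toℚ ∘ g) xs ≡ toℚ (sum (map g xs))
  ∑-toℚ g []       = refl
  ∑-toℚ g (x ∷ xs) = trans (cong (toℚ (g x) +_) (∑-toℚ g xs)) (sym (toℚ-+ (g x) (sum (map g xs))))

  ∑-const : ∀ c (xs : List A) → ∑ (λ _ → c) xs ≡ toℚ (length xs) * c
  ∑-const c []       = sym (ℚ.*-zeroˡ c)
  ∑-const c (x ∷ xs) = begin-equality
    c + ∑ (λ _ → c) xs          ≡⟨ cong (c +_) (∑-const c xs) ⟩
    c + toℚ (length xs) * c     ≡⟨ solve 2 (λ c l → c :+ l :* c := (con 1ℚ :+ l) :* c) refl c (toℚ (length xs)) ⟩
    (1ℚ + toℚ (length xs)) * c  ≡⟨ cong (_* c) (toℚ-+ 1 (length xs)) ⟨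
    toℚ (suc (length xs)) * c   ∎

  ∑-mono-≤ : ∀ {g h : A → ℚ} {xs} → All (λ x → g x ≤ℚ h x) xs → ∑ g xs ≤ℚ ∑ h xs
  ∑-mono-≤ []           = ℚ.≤-refl
  ∑-mono-≤ (gx≤hx ∷ ps) = ℚ.+-mono-≤ gx≤hx (∑-mono-≤ ps)

  ∑-nonNeg : ∀ {g : A → ℚ} xs → (∀ x → 0ℚ ≤ℚ g x) → 0ℚ ≤ℚ ∑ g xs
  ∑-nonNeg xs g≥0 = ℚ.≤-trans (ℚ.≤-reflexive (sym (ℚ∑.∑-ε xs))) (∑-mono-≤ (All.universal g≥0 xs))

module _ (f : ℕ → ℚ) where

  NonDecreasing⇒monotone : NonDecreasing f → ∀ {x y} → x ≤ y → f x ≤ℚ f y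
  NonDecreasing⇒monotone f↑ {x} x≤y with ℕ.m≤n⇒∃[o]m+o≡n x≤y
  ... | o , refl = go o
    where
    go : ∀ o → f x ≤ℚ f (x ℕ.+ o)
    go zero    = ℚ.≤-reflexive (cong f (sym (ℕ.+-identityʳ x)))
    go (suc o) = ℚ.≤-trans (go o) (ℚ.≤-trans (f↑ (x ℕ.+ o)) (ℚ.≤-reflexive (cong f (sym (ℕ.+-suc x o)))))

  module _ (concave : Concave f) where

    private
      Δ : ℕ → ℚ
      Δ x = f (suc x) - f x

      Δ-antitone : ∀ x d → Δ (d ℕ.+ x) ≤ℚ Δ x
      Δ-antitone x zero    = ℚ.≤-refl
      Δ-antitone x (suc d) = ℚ.≤-trans (concave (d ℕ.+ x)) (Δ-antitone x d)

      *Δ≤increase : ∀ c d → toℚ c * Δ (c ℕ.+ d) ≤ℚ f c - f 0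
      *Δ≤increase zero    d = ℚ.≤-reflexive (trans (ℚ.*-zeroˡ (Δ d)) (sym (ℚ.+-inverseʳ (f 0))))
      *Δ≤increase (suc c) d = begin
        toℚ (suc c) * Δ (suc c ℕ.+ d)
          ≡⟨ cong (_* Δ (suc c ℕ.+ d)) (toℚ-+ 1 c) ⟩
        (1ℚ + toℚ c) * Δ (suc c ℕ.+ d)
          ≡⟨ solve 2 (λ k δ → (con 1ℚ :+ k) :* δ := k :* δ :+ δ) refl (toℚ c) (Δ (suc c ℕ.+ d)) ⟩
        toℚ c * Δ (suc c ℕ.+ d) + Δ (suc c ℕ.+ d)
          ≡⟨ cong₂ (λ x y → toℚ c * Δ x + Δ y) (sym (ℕ.+-suc c d)) (cong suc (ℕ.+-comm c d)) ⟩
        toℚ c * Δ (c ℕ.+ suc d) + Δ (suc d ℕ.+ c)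
          ≤⟨ ℚ.+-mono-≤ (*Δ≤increase c (suc d)) (Δ-antitone c (suc d)) ⟩
        (f c - f 0) + Δ c
          ≡⟨ solve 3 (λ a b z → (a :- z) :+ (b :- a) := b :- z) refl (f c) (f (suc c)) (f 0) ⟩
        f (suc c) - f 0 ∎

    ratio-antitone : 0ℚ ≤ℚ f 0 → ∀ {c u} → c ≤ u → toℚ c * f u ≤ℚ toℚ u * f c
    ratio-antitone f0≥0 {c} c≤u with ℕ.m≤n⇒∃[o]m+o≡n c≤u
    ... | o , refl = go o
      where
      *Δ≤f : ∀ d → toℚ c * Δ (c ℕ.+ d) ≤ℚ f c
      *Δ≤f d = ℚ.≤-trans (*Δ≤increase c d)
        (ℚ.≤-trans (ℚ.+-monoʳ-≤ (f c) (ℚ.neg-antimono-≤ f0≥0)) (ℚ.≤-reflexive (ℚ.+-identityʳ (f c))))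

      go : ∀ o → toℚ c * f (c ℕ.+ o) ≤ℚ toℚ (c ℕ.+ o) * f c
      go zero rewrite ℕ.+-identityʳ c = ℚ.≤-refl
      go (suc o) = begin
        toℚ c * f (c ℕ.+ suc o)
          ≡⟨ cong (λ x → toℚ c * f x) (ℕ.+-suc c o) ⟩
        toℚ c * f (suc (c ℕ.+ o))
          ≡⟨ solve 3 (λ k a b → k :* b := k :* a :+ k :* (b :- a)) refl (toℚ c) (f (c ℕ.+ o)) (f (suc (c ℕ.+ o))) ⟩
        toℚ c * f (c ℕ.+ o) + toℚ c * Δ (c ℕ.+ o)
          ≤⟨ ℚ.+-mono-≤ (go o) (*Δ≤f o) ⟩
        toℚ (c ℕ.+ o) * f c + f c
          ≡⟨ solve 2 (λ k a → k :* a :+ a := (k :+ con 1ℚ) :* a) refl (toℚ (c ℕ.+ o)) (f c) ⟩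
        (toℚ (c ℕ.+ o) + 1ℚ) * f c
          ≡⟨ cong (_* f c) (toℚ-+ (c ℕ.+ o) 1) ⟨
        toℚ (c ℕ.+ o ℕ.+ 1) * f c
          ≡⟨ cong (λ x → toℚ x * f c) (trans (ℕ.+-assoc c o 1) (cong (c ℕ.+_) (ℕ.+-comm o 1))) ⟩
        toℚ (c ℕ.+ suc o) * f c ∎

    ratio-antitone-∑ : NonNeg f → ∀ {A : Set} {u} m d (c : A → ℕ) xs → 1 ≤ u → (∀ x → c x ≤ u) →
                       m ℕ.* u ≤ d ℕ.* sum (map c xs) → toℚ m * f u ≤ℚ toℚ d * ∑ (f ∘ c) xs
    ratio-antitone-∑ f≥0 {u = u@(suc _)} m d c xs _ c≤u mu≤d∑c = ℚ.*-cancelˡ-≤-pos (toℚ u) {{toℚ-pos u}} (begin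
      toℚ u * (toℚ m * f u)                  ≡⟨ x∙yz≈yx∙z (toℚ u) (toℚ m) (f u) ⟩
      (toℚ m * toℚ u) * f u                  ≡⟨ cong (_* f u) (toℚ-* m u) ⟨
      toℚ (m ℕ.* u) * f u                    ≤⟨ toℚ-*-monoˡ-≤ (f u) (f≥0 u) mu≤d∑c ⟩
      toℚ (d ℕ.* sum (map c xs)) * f u       ≡⟨ cong (_* f u) (toℚ-* d (sum (map c xs))) ⟩
      (toℚ d * toℚ (sum (map c xs))) * f u   ≡⟨ cong (λ s → (toℚ d * s) * f u) (∑-toℚ c xs) ⟨
      (toℚ d * ∑ (toℚ ∘ c) xs) * f u         ≡⟨ ℚ.*-assoc (toℚ d) (∑ (toℚ ∘ c) xs) (f u) ⟩
      toℚ d * (∑ (toℚ ∘ c) xs * f u)         ≡⟨ cong (toℚ d *_) (∑-*ʳ (f u) (toℚ ∘ c) xs) ⟨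
      toℚ d * ∑ (λ x → toℚ (c x) * f u) xs   ≤⟨ ℚ.*-monoˡ-≤-nonNeg (toℚ d) {{toℚ-nonNeg d}} (∑-mono-≤ chords) ⟩
      toℚ d * ∑ (λ x → toℚ u * f (c x)) xs   ≡⟨ cong (toℚ d *_) (∑-*ˡ (toℚ u) (f ∘ c) xs) ⟩
      toℚ d * (toℚ u * ∑ (f ∘ c) xs)         ≡⟨ x∙yz≈y∙xz (toℚ d) (toℚ u) (∑ (f ∘ c) xs) ⟩
      toℚ u * (toℚ d * ∑ (f ∘ c) xs)         ∎)
      where
      chords : All (λ x → toℚ (c x) * f u ≤ℚ toℚ u * f (c x)) xs
      chords = All.universal (λ x → ratio-antitone (f≥0 0) (c≤u x)) xs

module Revenue {n} (I : Instance n) (f : ℕ → ℚ) (f≥0 : NonNeg f) (f↑ : NonDecreasing f) (concave : Concave f) where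
  open Instance I

  private
    weighted-nonNeg : ∀ i x → 0ℚ ≤ℚ toℚ (w i) * f x
    weighted-nonNeg i x = ℚ.nonNegative⁻¹ _
      {{ℚ.nonNeg*nonNeg⇒nonNeg (toℚ (w i)) {{toℚ-nonNeg (w i)}} (f x) {{ℚ.nonNegative (f≥0 x)}}}}

  rev-within-bound : ∀ i F → inter I f i F ≤ u i → rev I f i F ≡ toℚ (w i) * f (inter I f i F)
  rev-within-bound i F c≤u with inter I f i F ≤ᵇ u i | ℕ.≤⇒≤ᵇ c≤u
  ... | true | _ = refl

  rev≤cap : ∀ i F → rev I f i F ≤ℚ toℚ (w i) * f (u i)
  rev≤cap i F with inter I f i F ≤ᵇ u i in c≤ᵇu
  ... | true  = ℚ.*-monoˡ-≤-nonNeg (toℚ (w i)) {{toℚ-nonNeg (w i)}}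
                  (NonDecreasing⇒monotone f f↑ (ℕ.≤ᵇ⇒≤ _ _ (from T-≡ c≤ᵇu)))
  ... | false = weighted-nonNeg i (u i)

  revM-nonNeg : ∀ M F → 0ℚ ≤ℚ revM I f M F
  revM-nonNeg M F = ∑-nonNeg (allFin k) masked
    where
    masked : ∀ i → 0ℚ ≤ℚ (if M i then rev I f i F else 0ℚ)
    masked i with M i | inter I f i F ≤ᵇ u i
    ... | true  | true  = weighted-nonNeg i (inter I f i F)
    ... | true  | false = ℚ.≤-refl
    ... | false | _     = ℚ.≤-refl

  revM-cong : ∀ M {F G} → (∀ t → F t ≡ G t) → revM I f M F ≡ revM I f M G
  revM-cong M F≗G = cong sumℚ (map-cong (λ i → cong (revIn i) (count-cong F≗G (P I f i))) (allFin k))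
    where
    revIn : Fin k → ℕ → ℚ
    revIn i c = if M i then (if c ≤ᵇ u i then toℚ (w i) * f c else 0ℚ) else 0ℚ

  revM-mono : ∀ M {F G} → (∀ i → T (M i) → rev I f i F ≤ℚ rev I f i G) → revM I f M F ≤ℚ revM I f M G
  revM-mono M {F} {G} F≤G = ∑-mono-≤ (All.universal masked (allFin k))
    where
    masked : ∀ i → (if M i then rev I f i F else 0ℚ) ≤ℚ (if M i then rev I f i G else 0ℚ)
    masked i with M i | F≤G i
    ... | true  | Fi≤Gi = Fi≤Gi _
    ... | false | _     = ℚ.≤-refl

  revM-*-∑ : ∀ M {A : Set} {F} c d (G : A → EdgeSet) θs →
             (∀ i → T (M i) → c * rev I f i F ≤ℚ d * ∑ (λ θ → rev I f i (G θ)) θs) →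
             c * revM I f M F ≤ℚ d * ∑ (λ θ → revM I f M (G θ)) θs
  revM-*-∑ M {F = F} c d G θs bound = begin
    c * revM I f M F                                       ≡⟨ ∑-*ˡ c (masked F) (allFin k) ⟨
    ∑ (λ i → c * masked F i) (allFin k)                    ≤⟨ ∑-mono-≤ (All.universal masked-bound (allFin k)) ⟩
    ∑ (λ i → d * ∑ (λ θ → masked (G θ) i) θs) (allFin k)  ≡⟨ ∑-*ˡ d (λ i → ∑ (λ θ → masked (G θ) i) θs) (allFin k) ⟩
    d * ∑ (λ i → ∑ (λ θ → masked (G θ) i) θs) (allFin k)  ≡⟨ cong (d *_) (ℚ∑.∑-comm (λ i θ → masked (G θ) i) (allFin k) θs) ⟩
    d * ∑ (λ θ → revM I f M (G θ)) θs                      ∎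
    where
    masked : EdgeSet → Fin k → ℚ
    masked F i = if M i then rev I f i F else 0ℚ

    masked-bound : ∀ i → c * masked F i ≤ℚ d * ∑ (λ θ → masked (G θ) i) θs
    masked-bound i with M i | bound i
    ... | true  | bi = bi _
    ... | false | _  = ℚ.≤-reflexive (begin-equality
      c * 0ℚ               ≡⟨ ℚ.*-zeroʳ c ⟩
      0ℚ                   ≡⟨ ℚ.*-zeroʳ d ⟨
      d * 0ℚ               ≡⟨ cong (d *_) (ℚ∑.∑-ε θs) ⟨
      d * ∑ (λ _ → 0ℚ) θs  ∎)

  rev-M₀≤rev-∅ : ∀ i F → T (Mclass I f 0 i) → rev I f i F ≤ℚ rev I f i F₀
  rev-M₀≤rev-∅ i F u≡ᵇ0 = begin
    rev I f i F                     ≤⟨ rev≤cap i F ⟩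
    toℚ (w i) * f (u i)             ≡⟨ cong (λ x → toℚ (w i) * f x) (trans (ℕ.≡ᵇ⇒≡ (u i) 0 u≡ᵇ0) (sym ∅-misses)) ⟩
    toℚ (w i) * f (inter I f i F₀)  ≡⟨ rev-within-bound i F₀ (subst (_≤ u i) (sym ∅-misses) z≤n) ⟨
    rev I f i F₀                    ∎
    where
    ∅-misses : inter I f i F₀ ≡ 0
    ∅-misses = count-none (P I f i)

  revM-M₀≤revM-∅ : ∀ F → revM I f (Mclass I f 0) F ≤ℚ revM I f (Mclass I f 0) F₀
  revM-M₀≤revM-∅ F = revM-mono (Mclass I f 0) (λ i → rev-M₀≤rev-∅ i F)

  module _ (j : ℕ) where
    private
      N : ℕ
      N = 2 ^ suc j

      instance
        N≢0 : NonZero N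
        N≢0 = ℕ.m^n≢0 2 (suc j)

      M : Fin k → Bool
      M = Mclass I f (suc j)

      G : ℕ → EdgeSet
      G = Fjθ (suc j)

    open Residues N

    Mclass-bounds : ∀ i → T (M i) → 1 ≤ u i × len I f i < N ℕ.* u i × 2 ^ j ℕ.* u i ≤ len I f i
    Mclass-bounds i i∈M with to T-∧ i∈M
    ... | u≥1 , len-bounds with to T-∧ len-bounds
    ... | len< , len≥ = ℕ.≤ᵇ⇒≤ 1 (u i) u≥1 , ℕ.<ᵇ⇒< _ _ len< , ℕ.≤ᵇ⇒≤ _ _ len≥

    rev-Mclass≤∑ : ∀ i F → T (M i) → toℚ N * rev I f i F ≤ℚ toℚ 2 * ∑ (λ θ → rev I f i (G θ)) (seg 0 N)
    rev-Mclass≤∑ i F i∈M with Mclass-bounds i i∈M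
    ... | u≥1 , len<Nu , 2ʲu≤len = begin
      toℚ N * rev I f i F
        ≤⟨ ℚ.*-monoˡ-≤-nonNeg (toℚ N) {{toℚ-nonNeg N}} (rev≤cap i F) ⟩
      toℚ N * (toℚ (w i) * f (u i))
        ≡⟨ x∙yz≈y∙xz (toℚ N) (toℚ (w i)) (f (u i)) ⟩
      toℚ (w i) * (toℚ N * f (u i))
        ≤⟨ ℚ.*-monoˡ-≤-nonNeg (toℚ (w i)) {{toℚ-nonNeg (w i)}}
             (ratio-antitone-∑ f concave f≥0 N 2 hits (seg 0 N) u≥1 hits≤u Nu≤2∑hits) ⟩
      toℚ (w i) * (toℚ 2 * ∑ (f ∘ hits) (seg 0 N))
        ≡⟨ x∙yz≈y∙xz (toℚ (w i)) (toℚ 2) (∑ (f ∘ hits) (seg 0 N)) ⟩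
      toℚ 2 * (toℚ (w i) * ∑ (f ∘ hits) (seg 0 N))
        ≡⟨ cong (toℚ 2 *_) (∑-*ˡ (toℚ (w i)) (f ∘ hits) (seg 0 N)) ⟨
      toℚ 2 * ∑ (λ θ → toℚ (w i) * f (hits θ)) (seg 0 N)
        ≡⟨ cong (λ xs → toℚ 2 * sumℚ xs) (map-cong (λ θ → rev-within-bound i (G θ) (hits≤u θ)) (seg 0 N)) ⟨
      toℚ 2 * ∑ (λ θ → rev I f i (G θ)) (seg 0 N) ∎
      where
      hits : ℕ → ℕ
      hits θ = inter I f i (G θ)

      hits≤u : ∀ θ → hits θ ≤ u i
      hits≤u θ = count-residue-seg θ (a i) (u i)
        (subst₂ _≤_ (length-seg (a i) (suc (b i) ℕ.∸ a i)) (ℕ.*-comm N (u i)) (ℕ.<⇒≤ len<Nu))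

      Nu≤2∑hits : N ℕ.* u i ≤ 2 ℕ.* sum (map hits (seg 0 N))
      Nu≤2∑hits = subst₂ _≤_ (sym (ℕ.*-assoc 2 (2 ^ j) (u i))) (cong (2 ℕ.*_) (sym (∑-count-residue (P I f i))))
                    (ℕ.*-monoʳ-≤ 2 2ʲu≤len)

    ∑-candidates≤best : ∀ θb → BestCandidate I f (suc j) θb →
                        ∑ (λ θ → revM I f M (G θ)) (seg 0 N) ≤ℚ toℚ N * revM I f M (G θb)
    ∑-candidates≤best θb (_ , _ , best) = begin
      ∑ (λ θ → revM I f M (G θ)) (seg 0 N)        ≤⟨ ∑-mono-≤ (All.map (candidate≤best ∘ proj₂) (seg-bounds 0 N)) ⟩
      ∑ (λ _ → revM I f M (G θb)) (seg 0 N)       ≡⟨ ∑-const (revM I f M (G θb)) (seg 0 N) ⟩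
      toℚ (length (seg 0 N)) * revM I f M (G θb)  ≡⟨ cong (λ l → toℚ l * revM I f M (G θb)) (length-seg 0 N) ⟩
      toℚ N * revM I f M (G θb)                   ∎
      where
      candidate≤best : ∀ {θ} → θ < N → revM I f M (G θ) ≤ℚ revM I f M (G θb)
      -- the candidates are θ ∈ {1, …, N}; θ = 0 is the same residue class as θ = N
      candidate≤best {zero}  _   = subst (_≤ℚ revM I f M (G θb)) (revM-cong M (residue-periodic 0))
                                         (best N (ℕ.m^n>0 2 (suc j)) ℕ.≤-refl)
      candidate≤best {suc θ} θ<N = best (suc θ) (s≤s z≤n) (ℕ.<⇒≤ θ<N)

    revM-Mclass≤2*best : ∀ F θb → BestCandidate I f (suc j) θb → revM I f M F ≤ℚ toℚ 2 * revM I f M (G θb)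
    revM-Mclass≤2*best F θb θb-best = ℚ.*-cancelˡ-≤-pos (toℚ N) {{toℚ-pos N}} (begin
      toℚ N * revM I f M F
        ≤⟨ revM-*-∑ M (toℚ N) (toℚ 2) G (seg 0 N) (λ i → rev-Mclass≤∑ i F) ⟩
      toℚ 2 * ∑ (λ θ → revM I f M (G θ)) (seg 0 N)
        ≤⟨ ℚ.*-monoˡ-≤-nonNeg (toℚ 2) {{toℚ-nonNeg 2}} (∑-candidates≤best θb θb-best) ⟩
      toℚ 2 * (toℚ N * revM I f M (G θb))
        ≡⟨ x∙yz≈y∙xz (toℚ 2) (toℚ N) (revM I f M (G θb)) ⟩
      toℚ N * (toℚ 2 * revM I f M (G θb)) ∎)

corollary3 : (n : ℕ) → 1 ≤ n → (I : Instance n) → (f : ℕ → ℚ) →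
    NonNeg f → NonDecreasing f → Concave f →
    (F* : EdgeSet) → Optimal I f F* →
      (revM I f (Mclass I f 0) F* ≤ℚ toℚ 6 * revM I f (Mclass I f 0) F₀) ×
      (∀ j → suc j ≤ ⌈log₂ n ⌉ → ∀ θ → BestCandidate I f (suc j) θ →
        revM I f (Mclass I f (suc j)) F* ≤ℚ toℚ 6 * revM I f (Mclass I f (suc j)) (Fjθ (suc j) θ))
corollary3 n _ I f f≥0 f↑ concave F* _ =
    ℚ.≤-trans (revM-M₀≤revM-∅ F*) (≤-toℚ-* {6} _ (revM-nonNeg (Mclass I f 0) F₀) (s≤s z≤n))
  , λ j _ θ θ-best → ℚ.≤-trans (revM-Mclass≤2*best j F* θ θ-best)
      (toℚ-*-monoˡ-≤ {2} {6} _ (revM-nonNeg (Mclass I f (suc j)) (Fjθ (suc j) θ)) (s≤s (s≤s z≤n)))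
  where open Revenue I f f≥0 f↑ concave
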